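{- Let $n\ge 3$, let $1\le i_0<j_0\le n$ with $j_0\ge i_0+2$, let $\alpha=\varepsilon_{i_0}-\varepsilon_{j_0}$, $s=s_\alpha$, and let $w\in S_n$ satisfy $w(i_0)<w(j_0)$ and such that no $k$ with $i_0<k<j_0$ satisfies $w(i_0)<w(k)<w(j_0)$; put $w'=ws$. Let $\beta$ be a bad negative root sharing the row of $\alpha$. Then $(\beta_1,\beta_2)\mapsto(\beta_1,s(\beta_2))$ is a bijection from $\mathfrak{A}_\beta$ onto the set of elements $(\beta_1,\beta_2)\in\mathfrak{A}_{s(\beta)}$ with $\beta_2\ne-\alpha$. Moreover, if $(\beta_1,\beta_2)\in\mathfrak{A}_\beta$ then $\beta_2$ is bad.
   Context: $S_n$ acts on $\mathbb{Z}^n$ by $w(\varepsilon_i)=\varepsilon_{w(i)}$. For $l\ne m$, $\alpha_{lm}=\varepsilon_l-\varepsilon_m$, positive if $l<m$, negative if $l>m$; $w(\alpha_{lm})=\alpha_{w(l)w(m)}$. $s=s_\alpha$ is the transposition $(i_0\,j_0)$ acting by $s(\alpha_{lm})=\alpha_{s(l)s(m)}$. $\delta_P$ is $1$ if $P$ holds, else $0$. For a negative root $\beta=\alpha_{lm}$: it shares the row of $\alpha$ if $l=i_0$, the column of $\alpha$ if $m=j_0$, the row of $-\alpha$ if $l=j_0$, the column of $-\alpha$ if $m=i_0$. $\beta$ is bad if it shares the row or column of $\alpha$ and $\delta_{w(\beta)<0}\ne\delta_{w'(\beta)<0}$. $\kappa_\beta=\delta_{w'(\beta)<0}$ if $l=j_0$,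 and $\kappa_\beta=\delta_{w(\beta)<0}$ otherwise. $\mathfrak{D}_\beta=\{(\alpha_{km},\alpha_{lk}):m<k<l\}$, and for any negative root $\gamma$, $\mathfrak{A}_\gamma=\{(\gamma_1,\gamma_2)\in\mathfrak{D}_\gamma:\kappa_\gamma=\kappa_{\gamma_1}+\kappa_{\gamma_2}\}$. -}

module Defs where

open import Data.Nat using (ℕ; zero; suc; _+_)
open import Data.Fin using (Fin; _<_; _<?_; _≟_)
open import Data.Fin.Permutation using (Permutation′; _⟨$⟩ʳ_; transpose; _∘ₚ_)
open import Data.Product using (Σ; _×_; _,_; proj₁; proj₂)
open import Data.Sum using (_⊎_)
open import Data.Bool using (if_then_else_)
open import Relation.Nullary using (does; ¬_)
open import Relation.Binary.PropositionalEquality using (_≡_; _≢_)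

-- Indices are 0-based (Fin n) instead of 1..n.
-- A root α_lm = ε_l - ε_m (l ≢ m) is represented by the pair (l , m).
Root : ℕ → Set
Root n = Fin n × Fin n

IsNeg : ∀ {n} → Root n → Set
IsNeg (l , m) = m < l

δneg : ∀ {n} → Root n → ℕ
δneg (l , m) = if does (m <? l) then 1 else 0

act : ∀ {n} → Permutation′ n → Root n → Root n
act w (l , m) = (w ⟨$⟩ʳ l , w ⟨$⟩ʳ m)

sPerm : ∀ {n} → Fin n → Fin n → Permutation′ n
sPerm i0 j0 = transpose i0 j0

-- w' = w s  (as functions: w' x = w (s x); π₁ ∘ₚ π₂ applies π₁ first)
w′ : ∀ {n} → Permutation′ n → Fin n → Fin n → Permutation′ n
w′ w i0 j0 = sPerm i0 j0 ∘ₚ w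

κ : ∀ {n} → Permutation′ n → Fin n → Fin n → Root n → ℕ
κ w i0 j0 (l , m) =
  if does (l ≟ j0) then δneg (act (w′ w i0 j0) (l , m)) else δneg (act w (l , m))

SharesRowOrColα : ∀ {n} → Fin n → Fin n → Root n → Set
SharesRowOrColα i0 j0 (l , m) = (l ≡ i0) ⊎ (m ≡ j0)

Bad : ∀ {n} → Permutation′ n → Fin n → Fin n → Root n → Set
Bad w i0 j0 β =
  IsNeg β × SharesRowOrColα i0 j0 β × (δneg (act w β) ≢ δneg (act (w′ w i0 j0) β))

InD : ∀ {n} → Root n → Root n × Root n → Set
InD {n} (l , m) (β₁ , β₂) =
  Σ (Fin n) λ k → (m < k) × (k < l) × (β₁ ≡ (k , m)) × (β₂ ≡ (l , k))

InA : ∀ {n} → Permutation′ n → Fin n → Fin n → Root n → Root n × Root n → Set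
InA w i0 j0 γ (γ₁ , γ₂) =
  InD γ (γ₁ , γ₂) × (κ w i0 j0 γ ≡ κ w i0 j0 γ₁ + κ w i0 j0 γ₂)

φ : ∀ {n} → Fin n → Fin n → Root n × Root n → Root n × Root n
φ i0 j0 (β₁ , β₂) = (β₁ , act (sPerm i0 j0) β₂)

{-# OPTIONS --safe #-}
-- Write β = (i₀ , m) with m < i₀.  Since s fixes every index other than i₀, j₀ and
-- κ reads the row j₀ through w′ = w s, we get κ (i₀ , k) = κ (j₀ , k) for all such k;
-- hence the defining equation of 𝔄 is literally the same for the pair
-- ((k , m) , (i₀ , k)) ∈ 𝔄_β and for its image ((k , m) , (j₀ , k)) ∈ 𝔄_{s β}.
-- Badness of β means w(i₀) < w(m) < w(j₀), so κ_β = 0 and membership at k means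
-- w(i₀) < w(k) < w(m).  The only extra candidates in 𝔄_{s β} have i₀ < k < j₀ (and
-- k = i₀ is excluded by β₂ ≠ -α); for them w(i₀) < w(k) < w(j₀), which the gap
-- hypothesis on w forbids.  Finally w(i₀) < w(k) < w(j₀) for k < i₀ makes (i₀ , k) bad.
module Submission where

open import Defs
open import Data.Nat using (ℕ; _+_; _≤_)
open import Data.Nat.Properties using (m+n≡0⇒m≡0; m+n≡0⇒n≡0)
open import Data.Fin using (Fin; toℕ; _<_; _<?_; _≟_)
open import Data.Fin.Properties using (<-cmp; <-trans; <-asym; <⇒≢)
open import Data.Fin.Permutation using (Permutation′; _⟨$⟩ʳ_)
import Data.Fin.Permutation.Components as PC
open import Data.Product using (Σ; _×_; _,_; proj₁; proj₂)
open import Data.Sum using (inj₁)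
open import Function using (_∘_)
open import Function.Bundles using (Injection)
open import Function.Properties.Inverse using (↔⇒↣)
open import Relation.Nullary using (¬_; yes; no; contradiction)
open import Relation.Nullary.Decidable using (dec-true; dec-false)
open import Relation.Binary.Definitions using (tri<; tri≈; tri>)
open import Relation.Binary.PropositionalEquality
  using (_≡_; _≢_; refl; sym; trans; cong; cong₂; subst; subst₂; module ≡-Reasoning)

module _ {n : ℕ} where

  transpose-matchˡ : (i j : Fin n) → PC.transpose i j i ≡ j
  transpose-matchˡ i j rewrite dec-true (i ≟ i) refl = refl

  transpose-matchʳ : {i j : Fin n} → i ≢ j → PC.transpose i j j ≡ i
  transpose-matchʳ {i} {j} i≢j
    rewrite dec-false (j ≟ i) (i≢j ∘ sym) | dec-true (j ≟ j) refl = refl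

  transpose-mismatch : {i j k : Fin n} → k ≢ i → k ≢ j → PC.transpose i j k ≡ k
  transpose-mismatch {i} {j} {k} k≢i k≢j
    rewrite dec-false (k ≟ i) k≢i | dec-false (k ≟ j) k≢j = refl

  ≮∧≢⇒< : {i j : Fin n} → ¬ j < i → i ≢ j → i < j
  ≮∧≢⇒< {i} {j} j≮i i≢j with <-cmp i j
  ... | tri< i<j _ _ = i<j
  ... | tri≈ _ i≡j _ = contradiction i≡j i≢j
  ... | tri> _ _ j<i = contradiction j<i j≮i

  δneg-< : {a b : Fin n} → b < a → δneg (a , b) ≡ 1
  δneg-< {a} {b} b<a rewrite dec-true (b <? a) b<a = refl

  δneg-≮ : {a b : Fin n} → ¬ b < a → δneg (a , b) ≡ 0
  δneg-≮ {a} {b} b≮a rewrite dec-false (b <? a) b≮a = refl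

  δneg≡0⇒≮ : {a b : Fin n} → δneg (a , b) ≡ 0 → ¬ b < a
  δneg≡0⇒≮ {a} {b} δ≡0 b<a = contradiction (trans (sym (δneg-< b<a)) δ≡0) λ ()

  δneg≡0⇒< : {a b : Fin n} → a ≢ b → δneg (a , b) ≡ 0 → a < b
  δneg≡0⇒< a≢b δ≡0 = ≮∧≢⇒< (δneg≡0⇒≮ δ≡0) a≢b

  between⇒δneg≢ : {a b c : Fin n} → a < c → c < b → δneg (a , c) ≢ δneg (b , c)
  between⇒δneg≢ a<c c<b δ≡δ =
    contradiction (trans (sym (δneg-≮ (<-asym a<c))) (trans δ≡δ (δneg-< c<b))) λ ()

  δneg≢⇒between : {a b c : Fin n} → a < b → c ≢ a →
                  δneg (a , c) ≢ δneg (b , c) → a < c × c < b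
  δneg≢⇒between {a} {b} {c} a<b c≢a δ≢δ with c <? a | c <? b
  ... | yes c<a | _       = contradiction (trans (δneg-< c<a) (sym (δneg-< (<-trans c<a a<b)))) δ≢δ
  ... | no c≮a  | yes c<b = ≮∧≢⇒< c≮a (c≢a ∘ sym) , c<b
  ... | no c≮a  | no c≮b  = contradiction (trans (δneg-≮ c≮a) (sym (δneg-≮ c≮b))) δ≢δ

Between : ∀ {n} → Permutation′ n → Fin n → Fin n → Fin n → Set
Between w a k b = (w ⟨$⟩ʳ a < w ⟨$⟩ʳ k) × (w ⟨$⟩ʳ k < w ⟨$⟩ʳ b)

module _ {n : ℕ} (w : Permutation′ n) where

  permute-≢ : {a b : Fin n} → a ≢ b → w ⟨$⟩ʳ a ≢ w ⟨$⟩ʳ b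
  permute-≢ a≢b = a≢b ∘ Injection.injective (↔⇒↣ w)

  δneg-sum≡0⇒Between : {a k m : Fin n} → a ≢ k → k ≢ m →
                       0 ≡ δneg (act w (k , m)) + δneg (act w (a , k)) → Between w a k m
  δneg-sum≡0⇒Between a≢k k≢m sum≡0 =
    δneg≡0⇒< (permute-≢ a≢k) (m+n≡0⇒n≡0 _ (sym sum≡0)) ,
    δneg≡0⇒< (permute-≢ k≢m) (m+n≡0⇒m≡0 _ (sym sum≡0))

InD-proj₁-injective : ∀ {n} {β : Root n} {p q : Root n × Root n} →
                      InD β p → InD β q → proj₁ p ≡ proj₁ q → p ≡ q
InD-proj₁-injective (k , _ , _ , refl , refl) (.k , _ , _ , refl , refl) refl = refl

module _ {n : ℕ} (w : Permutation′ n) {i₀ j₀ : Fin n} (i₀≢j₀ : i₀ ≢ j₀) where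

  κ-≢j₀ : {l : Fin n} (m : Fin n) → l ≢ j₀ → κ w i₀ j₀ (l , m) ≡ δneg (act w (l , m))
  κ-≢j₀ {l} _ l≢j₀ rewrite dec-false (l ≟ j₀) l≢j₀ = refl

  κ-i₀≡κ-j₀ : {k : Fin n} → k ≢ i₀ → k ≢ j₀ → κ w i₀ j₀ (i₀ , k) ≡ κ w i₀ j₀ (j₀ , k)
  κ-i₀≡κ-j₀ k≢i₀ k≢j₀
    rewrite dec-false (i₀ ≟ j₀) i₀≢j₀ | dec-true (j₀ ≟ j₀) refl
          | transpose-matchʳ i₀≢j₀ | transpose-mismatch k≢i₀ k≢j₀ = refl

  act-s-row : {k : Fin n} → k ≢ i₀ → k ≢ j₀ → act (sPerm i₀ j₀) (i₀ , k) ≡ (j₀ , k)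
  act-s-row k≢i₀ k≢j₀ rewrite transpose-matchˡ i₀ j₀ | transpose-mismatch k≢i₀ k≢j₀ = refl

  δneg-w′-row : {k : Fin n} → k ≢ i₀ → k ≢ j₀ →
                δneg (act (w′ w i₀ j₀) (i₀ , k)) ≡ δneg (act w (j₀ , k))
  δneg-w′-row k≢i₀ k≢j₀ rewrite transpose-matchˡ i₀ j₀ | transpose-mismatch k≢i₀ k≢j₀ = refl

  κ-cond-i₀⇒j₀ : {k m : Fin n} → m ≢ i₀ → m ≢ j₀ → k ≢ i₀ → k ≢ j₀ →
                 κ w i₀ j₀ (i₀ , m) ≡ κ w i₀ j₀ (k , m) + κ w i₀ j₀ (i₀ , k) →
                 κ w i₀ j₀ (j₀ , m) ≡ κ w i₀ j₀ (k , m) + κ w i₀ j₀ (j₀ , k)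
  κ-cond-i₀⇒j₀ {k} {m} m≢i₀ m≢j₀ k≢i₀ k≢j₀ cond =
    trans (sym (κ-i₀≡κ-j₀ m≢i₀ m≢j₀))
          (trans cond (cong (κ w i₀ j₀ (k , m) +_) (κ-i₀≡κ-j₀ k≢i₀ k≢j₀)))

  κ-cond-j₀⇒i₀ : {k m : Fin n} → m ≢ i₀ → m ≢ j₀ → k ≢ i₀ → k ≢ j₀ →
                 κ w i₀ j₀ (j₀ , m) ≡ κ w i₀ j₀ (k , m) + κ w i₀ j₀ (j₀ , k) →
                 κ w i₀ j₀ (i₀ , m) ≡ κ w i₀ j₀ (k , m) + κ w i₀ j₀ (i₀ , k)
  κ-cond-j₀⇒i₀ {k} {m} m≢i₀ m≢j₀ k≢i₀ k≢j₀ cond =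
    trans (κ-i₀≡κ-j₀ m≢i₀ m≢j₀)
          (trans cond (cong (κ w i₀ j₀ (k , m) +_) (sym (κ-i₀≡κ-j₀ k≢i₀ k≢j₀))))

bad-row⇒Between : ∀ {n} (w : Permutation′ n) {i₀ j₀ m : Fin n} → i₀ < j₀ →
                  w ⟨$⟩ʳ i₀ < w ⟨$⟩ʳ j₀ → m < i₀ → Bad w i₀ j₀ (i₀ , m) → Between w i₀ m j₀
bad-row⇒Between w i₀<j₀ wi₀<wj₀ m<i₀ (_ , _ , δ≢δ′) =
  δneg≢⇒between wi₀<wj₀ (permute-≢ w (<⇒≢ m<i₀))
    (δ≢δ′ ∘ λ δ≡δ′ → trans δ≡δ′ (sym (δneg-w′-row w (<⇒≢ i₀<j₀) (<⇒≢ m<i₀) (<⇒≢ (<-trans m<i₀ i₀<j₀)))))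

module BadRow {n : ℕ} (w : Permutation′ n) {i₀ j₀ : Fin n} (i₀<j₀ : i₀ < j₀)
              {m : Fin n} (m<i₀ : m < i₀) (m-between : Between w i₀ m j₀) where

  private
    i₀≢j₀ : i₀ ≢ j₀
    i₀≢j₀ = <⇒≢ i₀<j₀

    <i₀⇒≢j₀ : {k : Fin n} → k < i₀ → k ≢ j₀
    <i₀⇒≢j₀ k<i₀ = <⇒≢ (<-trans k<i₀ i₀<j₀)

    κβ≡0 : κ w i₀ j₀ (i₀ , m) ≡ 0
    κβ≡0 = trans (κ-≢j₀ w i₀≢j₀ m i₀≢j₀) (δneg-≮ (<-asym (proj₁ m-between)))

  κ-cond⇒Between : {k : Fin n} → k ≢ i₀ → k ≢ j₀ → m ≢ k →
                   κ w i₀ j₀ (i₀ , m) ≡ κ w i₀ j₀ (k , m) + κ w i₀ j₀ (i₀ , k) →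
                   Between w i₀ k m
  κ-cond⇒Between {k} k≢i₀ k≢j₀ m≢k cond =
    δneg-sum≡0⇒Between w (k≢i₀ ∘ sym) (m≢k ∘ sym) (begin
      0                                             ≡⟨ sym κβ≡0 ⟩
      κ w i₀ j₀ (i₀ , m)                            ≡⟨ cond ⟩
      κ w i₀ j₀ (k , m) + κ w i₀ j₀ (i₀ , k)        ≡⟨ cong₂ _+_ (κ-≢j₀ w i₀≢j₀ m k≢j₀)
                                                                  (κ-≢j₀ w i₀≢j₀ k i₀≢j₀) ⟩
      δneg (act w (k , m)) + δneg (act w (i₀ , k))  ∎)
    where open ≡-Reasoning

  A-row⇒A-sβ : ∀ p → InA w i₀ j₀ (i₀ , m) p →
               InA w i₀ j₀ (act (sPerm i₀ j₀) (i₀ , m)) (φ i₀ j₀ p) × (proj₂ (φ i₀ j₀ p) ≢ (j₀ , i₀))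
  A-row⇒A-sβ .((k , m) , (i₀ , k)) ((k , m<k , k<i₀ , refl , refl) , cond) =
    subst₂ (InA w i₀ j₀) (sym sβ≡) (cong ((k , m) ,_) (sym sβ₂≡)) in-A-sβ ,
    <⇒≢ k<i₀ ∘ cong proj₂ ∘ trans (sym sβ₂≡)
    where
    sβ≡ : act (sPerm i₀ j₀) (i₀ , m) ≡ (j₀ , m)
    sβ≡ = act-s-row w i₀≢j₀ (<⇒≢ m<i₀) (<i₀⇒≢j₀ m<i₀)
    sβ₂≡ : act (sPerm i₀ j₀) (i₀ , k) ≡ (j₀ , k)
    sβ₂≡ = act-s-row w i₀≢j₀ (<⇒≢ k<i₀) (<i₀⇒≢j₀ k<i₀)
    in-A-sβ : InA w i₀ j₀ (j₀ , m) ((k , m) , (j₀ , k))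
    in-A-sβ = (k , m<k , <-trans k<i₀ i₀<j₀ , refl , refl) ,
              κ-cond-i₀⇒j₀ w i₀≢j₀ (<⇒≢ m<i₀) (<i₀⇒≢j₀ m<i₀) (<⇒≢ k<i₀) (<i₀⇒≢j₀ k<i₀) cond

  A-row⇒Bad : ∀ p → InA w i₀ j₀ (i₀ , m) p → Bad w i₀ j₀ (proj₂ p)
  A-row⇒Bad .((k , m) , (i₀ , k)) ((k , m<k , k<i₀ , refl , refl) , cond) =
    k<i₀ , inj₁ refl ,
    λ δ≡δ′ → between⇒δneg≢ wi₀<wk wk<wj₀
               (trans δ≡δ′ (δneg-w′-row w i₀≢j₀ (<⇒≢ k<i₀) (<i₀⇒≢j₀ k<i₀)))
    where
    k-between : Between w i₀ k m
    k-between = κ-cond⇒Between (<⇒≢ k<i₀) (<i₀⇒≢j₀ k<i₀) (<⇒≢ m<k) cond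
    wi₀<wk : w ⟨$⟩ʳ i₀ < w ⟨$⟩ʳ k
    wi₀<wk = proj₁ k-between
    wk<wj₀ : w ⟨$⟩ʳ k < w ⟨$⟩ʳ j₀
    wk<wj₀ = <-trans (proj₂ k-between) (proj₂ m-between)

  A-sβ⇒A-row : (∀ k → i₀ < k → k < j₀ → ¬ Between w i₀ k j₀) →
               ∀ q → InA w i₀ j₀ (act (sPerm i₀ j₀) (i₀ , m)) q → proj₂ q ≢ (j₀ , i₀) →
               Σ (Root n × Root n) λ p → InA w i₀ j₀ (i₀ , m) p × (φ i₀ j₀ p ≡ q)
  A-sβ⇒A-row no-between q q∈A = preimage q (subst (λ γ → InA w i₀ j₀ γ q) sβ≡ q∈A)
    where
    sβ≡ : act (sPerm i₀ j₀) (i₀ , m) ≡ (j₀ , m)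
    sβ≡ = act-s-row w i₀≢j₀ (<⇒≢ m<i₀) (<i₀⇒≢j₀ m<i₀)

    preimage : ∀ q → InA w i₀ j₀ (j₀ , m) q → proj₂ q ≢ (j₀ , i₀) →
               Σ (Root n × Root n) λ p → InA w i₀ j₀ (i₀ , m) p × (φ i₀ j₀ p ≡ q)
    preimage .((k , m) , (j₀ , k)) ((k , m<k , k<j₀ , refl , refl) , cond) q₂≢ with <-cmp k i₀
    ... | tri< k<i₀ _ _ =
      ((k , m) , (i₀ , k)) ,
      ((k , m<k , k<i₀ , refl , refl) ,
       κ-cond-j₀⇒i₀ w i₀≢j₀ (<⇒≢ m<i₀) (<i₀⇒≢j₀ m<i₀) (<⇒≢ k<i₀) (<⇒≢ k<j₀) cond) ,
      cong ((k , m) ,_) (act-s-row w i₀≢j₀ (<⇒≢ k<i₀) (<⇒≢ k<j₀))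
    ... | tri≈ _ k≡i₀ _ = contradiction (cong (j₀ ,_) k≡i₀) q₂≢
    ... | tri> _ _ i₀<k =
      contradiction (proj₁ k-between , <-trans (proj₂ k-between) (proj₂ m-between))
                    (no-between k i₀<k k<j₀)
      where
      k≢i₀ : k ≢ i₀
      k≢i₀ = <⇒≢ i₀<k ∘ sym
      k-between : Between w i₀ k m
      k-between = κ-cond⇒Between k≢i₀ (<⇒≢ k<j₀) (<⇒≢ m<k)
        (κ-cond-j₀⇒i₀ w i₀≢j₀ (<⇒≢ m<i₀) (<i₀⇒≢j₀ m<i₀) k≢i₀ (<⇒≢ k<j₀) cond)

lemma3p1p4 : (n : ℕ) → 3 ≤ n → (i₀ j₀ : Fin n) → i₀ < j₀ → 2 + toℕ i₀ ≤ toℕ j₀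
    → (w : Permutation′ n) → (w ⟨$⟩ʳ i₀) < (w ⟨$⟩ʳ j₀)
    → (∀ (k : Fin n) → i₀ < k → k < j₀ → ¬ (((w ⟨$⟩ʳ i₀) < (w ⟨$⟩ʳ k)) × ((w ⟨$⟩ʳ k) < (w ⟨$⟩ʳ j₀))))
    → (β : Root n) → IsNeg β → proj₁ β ≡ i₀ → Bad w i₀ j₀ β
    → ((∀ p → InA w i₀ j₀ β p
          → InA w i₀ j₀ (act (sPerm i₀ j₀) β) (φ i₀ j₀ p) × (proj₂ (φ i₀ j₀ p) ≢ (j₀ , i₀)))
      × (∀ p q → InA w i₀ j₀ β p → InA w i₀ j₀ β q → φ i₀ j₀ p ≡ φ i₀ j₀ q → p ≡ q)
      × (∀ q → InA w i₀ j₀ (act (sPerm i₀ j₀) β) q → proj₂ q ≢ (j₀ , i₀)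
          → Σ (Root n × Root n) λ p → InA w i₀ j₀ β p × (φ i₀ j₀ p ≡ q)))
      × (∀ p → InA w i₀ j₀ β p → Bad w i₀ j₀ (proj₂ p))
lemma3p1p4 _ _ i₀ j₀ i₀<j₀ _ w wi₀<wj₀ no-between (.i₀ , m) m<i₀ refl β-bad =
  (A-row⇒A-sβ ,
   (λ p q p∈A q∈A φp≡φq → InD-proj₁-injective (proj₁ p∈A) (proj₁ q∈A) (cong proj₁ φp≡φq)) ,
   A-sβ⇒A-row no-between) ,
  A-row⇒Bad
  where open BadRow w i₀<j₀ m<i₀ (bad-row⇒Between w i₀<j₀ wi₀<wj₀ m<i₀ β-bad)
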